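{- Let $P=(X,\prec)$ be a finite forest. Then \[ \prod_{x\in X}\alpha(x)\ \ge\ \prod_{x\in X}\beta(x). \]
   Context: $\alpha(x)=|\{y\in X: y\preccurlyeq x\}|$ and $\beta(x)=|\{y\in X: y\succcurlyeq x\}|$. A forest is a poset built from one-element posets by recursively taking disjoint sums $P+Q$ (union with no relations between the parts) and linear sums $C_1\oplus P$ with a one-element poset $C_1$ (the new element placed below every element of $P$). -}

module Defs where

open import Data.Nat using (ℕ; zero; suc; _+_; _≤_)
open import Data.Fin using (Fin; zero; suc; splitAt)
open import Data.Bool using (Bool; true; false)
open import Data.Sum using (inj₁; inj₂)
open import Data.List using (List; map; length; filterᵇ; allFin)
open import Data.Nat.ListAction using (product)

-- A finite forest on the carrier Fin n, built exactly as in the paper: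
-- from one-element posets by disjoint sums P + Q and linear sums C₁ ⊕ P.
data Forest : ℕ → Set where
  one  : Forest 1
  _⊞_  : ∀ {m n} → Forest m → Forest n → Forest (m + n)
  C₁⊕_ : ∀ {n} → Forest n → Forest (suc n)

-- In P + Q the elements of P are the first m indices, those of Q the rest.
-- In C₁ ⊕ P the new element is index zero, below every element.
_⊢_≼_ : ∀ {n} → Forest n → Fin n → Fin n → Bool
one ⊢ zero ≼ zero = true
(_⊞_ {m} P Q) ⊢ x ≼ y with splitAt m x | splitAt m y
... | inj₁ x′ | inj₁ y′ = P ⊢ x′ ≼ y′
... | inj₂ x′ | inj₂ y′ = Q ⊢ x′ ≼ y′
... | inj₁ _  | inj₂ _  = false
... | inj₂ _  | inj₁ _  = false
(C₁⊕ P) ⊢ zero ≼ y = true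
(C₁⊕ P) ⊢ suc x ≼ zero = false
(C₁⊕ P) ⊢ suc x ≼ suc y = P ⊢ x ≼ y

count : ∀ {n} → (Fin n → Bool) → ℕ
count {n} p = length (filterᵇ p (allFin n))

α : ∀ {n} → Forest n → Fin n → ℕ
α P x = count (λ y → P ⊢ y ≼ x)

β : ∀ {n} → Forest n → Fin n → ℕ
β P x = count (λ y → P ⊢ x ≼ y)

∏ : ∀ {n} → (Fin n → ℕ) → ℕ
∏ {n} f = product (map f (allFin n))

-- For every k, ∏ₓ (k + α x) ≥ C(n + k, k) · ∏ₓ β x, which at k = 0 is the claim.
-- Placing C₁ below a forest P raises every α by one and multiplies ∏ β by n + 1,
-- so the statement for C₁ ⊕ P at k follows from the one for P at k + 1; for a
-- disjoint sum P + Q both products split, and the binomial factors combine by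
-- C(m + n + k, k) ≤ C(m + k, k) · C(n + k, k).
module Submission where

open import Defs
open import Data.Nat using (ℕ; zero; suc; _+_; _*_; _≤_; _≥_; _!)
open import Data.Nat.Properties
open import Algebra.Properties.CommutativeSemigroup *-commutativeSemigroup using (x∙yz≈y∙xz; x∙yz≈yx∙z; xy∙z≈y∙xz)
open import Data.Nat.Tactic.RingSolver using (solve)
open import Data.Fin using (Fin; zero; suc; _↑ˡ_; _↑ʳ_)
open import Data.Fin.Properties using (splitAt-↑ˡ; splitAt-↑ʳ)
open import Data.Bool using (Bool; true; false)
open import Data.List using (List; []; _∷_; map; length; filterᵇ; allFin)
open import Data.List.Properties using (map-tabulate; map-cong; map-∘)
open import Data.Nat.ListAction using (product)
open import Function using (_∘_; id)
open import Relation.Binary.PropositionalEquality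

χ : Bool → ℕ
χ true  = 1
χ false = 0

length-filterᵇ-∷ : ∀ {A : Set} (p : A → Bool) x (xs : List A) →
  length (filterᵇ p (x ∷ xs)) ≡ χ (p x) + length (filterᵇ p xs)
length-filterᵇ-∷ p x xs with p x
... | true  = refl
... | false = refl

length-filterᵇ-map : ∀ {A B : Set} (p : B → Bool) (f : A → B) (xs : List A) →
  length (filterᵇ p (map f xs)) ≡ length (filterᵇ (p ∘ f) xs)
length-filterᵇ-map p f [] = refl
length-filterᵇ-map p f (x ∷ xs) with p (f x)
... | true  = cong suc (length-filterᵇ-map p f xs)
... | false = length-filterᵇ-map p f xs

allFin-suc : ∀ n → allFin (suc n) ≡ zero ∷ map suc (allFin n)
allFin-suc n = cong (zero ∷_) (sym (map-tabulate id suc))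

∏-suc : ∀ {n} (f : Fin (suc n) → ℕ) → ∏ f ≡ f zero * ∏ (f ∘ suc)
∏-suc {n} f = begin
  product (map f (allFin (suc n)))              ≡⟨ cong (product ∘ map f) (allFin-suc n) ⟩
  f zero * product (map f (map suc (allFin n))) ≡⟨ cong (λ xs → f zero * product xs) (map-∘ (allFin n)) ⟨
  f zero * ∏ (f ∘ suc)                          ∎
  where open ≡-Reasoning

count-suc : ∀ {n} (p : Fin (suc n) → Bool) →
  count p ≡ χ (p zero) + count (p ∘ suc)
count-suc {n} p = begin
  length (filterᵇ p (allFin (suc n)))            ≡⟨ cong (length ∘ filterᵇ p) (allFin-suc n) ⟩
  length (filterᵇ p (zero ∷ map suc (allFin n))) ≡⟨ length-filterᵇ-∷ p zero (map suc (allFin n)) ⟩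
  χ (p zero) + length (filterᵇ p (map suc (allFin n)))
    ≡⟨ cong (χ (p zero) +_) (length-filterᵇ-map p suc (allFin n)) ⟩
  χ (p zero) + count (p ∘ suc)                   ∎
  where open ≡-Reasoning

∏-cong : ∀ {n} {f g : Fin n → ℕ} → (∀ x → f x ≡ g x) → ∏ f ≡ ∏ g
∏-cong {n} f≗g = cong product (map-cong f≗g (allFin n))

∏-↑ : ∀ m {n} (f : Fin (m + n) → ℕ) → ∏ f ≡ ∏ (f ∘ (_↑ˡ n)) * ∏ (f ∘ (m ↑ʳ_))
∏-↑ zero    f = sym (+-identityʳ (∏ f))
∏-↑ (suc m) {n} f = begin
  ∏ f                                                       ≡⟨ ∏-suc f ⟩
  f zero * ∏ (f ∘ suc)                                      ≡⟨ cong (f zero *_) (∏-↑ m (f ∘ suc)) ⟩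
  f zero * (∏ (f ∘ suc ∘ (_↑ˡ n)) * ∏ (f ∘ (suc m ↑ʳ_)))  ≡⟨ *-assoc (f zero) _ _ ⟨
  (f zero * ∏ (f ∘ suc ∘ (_↑ˡ n))) * ∏ (f ∘ (suc m ↑ʳ_))  ≡⟨ cong (_* ∏ (f ∘ (suc m ↑ʳ_))) (∏-suc (f ∘ (_↑ˡ n))) ⟨
  ∏ (f ∘ (_↑ˡ n)) * ∏ (f ∘ (suc m ↑ʳ_))                     ∎
  where open ≡-Reasoning

count-cong : ∀ {n} {p q : Fin n → Bool} → (∀ x → p x ≡ q x) → count p ≡ count q
count-cong {zero}  p≗q = refl
count-cong {suc n} {p} {q} p≗q = begin
  count p                       ≡⟨ count-suc p ⟩
  χ (p zero) + count (p ∘ suc)  ≡⟨ cong₂ _+_ (cong χ (p≗q zero)) (count-cong (p≗q ∘ suc)) ⟩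
  χ (q zero) + count (q ∘ suc)  ≡⟨ count-suc q ⟨
  count q                       ∎
  where open ≡-Reasoning

count-none : ∀ {n} {p : Fin n → Bool} → (∀ x → p x ≡ false) → count p ≡ 0
count-none {zero}  p≗false = refl
count-none {suc n} {p} p≗false = begin
  count p                       ≡⟨ count-suc p ⟩
  χ (p zero) + count (p ∘ suc)  ≡⟨ cong₂ _+_ (cong χ (p≗false zero)) (count-none (p≗false ∘ suc)) ⟩
  0                             ∎
  where open ≡-Reasoning

count-all : ∀ n → count {n} (λ _ → true) ≡ n
count-all zero    = refl
count-all (suc n) = trans (count-suc {n} (λ _ → true)) (cong suc (count-all n))

count-↑ : ∀ m {n} (p : Fin (m + n) → Bool) →
  count p ≡ count (p ∘ (_↑ˡ n)) + count (p ∘ (m ↑ʳ_))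
count-↑ zero    p = refl
count-↑ (suc m) {n} p = begin
  count p                                                            ≡⟨ count-suc p ⟩
  χ (p zero) + count (p ∘ suc)                                       ≡⟨ cong (χ (p zero) +_) (count-↑ m (p ∘ suc)) ⟩
  χ (p zero) + (count (p ∘ suc ∘ (_↑ˡ n)) + count (p ∘ (suc m ↑ʳ_)))  ≡⟨ +-assoc (χ (p zero)) _ _ ⟨
  (χ (p zero) + count (p ∘ suc ∘ (_↑ˡ n))) + count (p ∘ (suc m ↑ʳ_))  ≡⟨ cong (_+ count (p ∘ (suc m ↑ʳ_))) (count-suc (p ∘ (_↑ˡ n))) ⟨
  count (p ∘ (_↑ˡ n)) + count (p ∘ (suc m ↑ʳ_))                      ∎
  where open ≡-Reasoning

module _ {m n} (P : Forest m) (Q : Forest n) where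

  ≼-↑ˡ↑ˡ : ∀ x y → (P ⊞ Q) ⊢ (x ↑ˡ n) ≼ (y ↑ˡ n) ≡ P ⊢ x ≼ y
  ≼-↑ˡ↑ˡ x y rewrite splitAt-↑ˡ m x n | splitAt-↑ˡ m y n = refl

  ≼-↑ʳ↑ʳ : ∀ x y → (P ⊞ Q) ⊢ (m ↑ʳ x) ≼ (m ↑ʳ y) ≡ Q ⊢ x ≼ y
  ≼-↑ʳ↑ʳ x y rewrite splitAt-↑ʳ m n x | splitAt-↑ʳ m n y = refl

  ≼-↑ˡ↑ʳ : ∀ x y → (P ⊞ Q) ⊢ (x ↑ˡ n) ≼ (m ↑ʳ y) ≡ false
  ≼-↑ˡ↑ʳ x y rewrite splitAt-↑ˡ m x n | splitAt-↑ʳ m n y = refl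

  ≼-↑ʳ↑ˡ : ∀ x y → (P ⊞ Q) ⊢ (m ↑ʳ x) ≼ (y ↑ˡ n) ≡ false
  ≼-↑ʳ↑ˡ x y rewrite splitAt-↑ʳ m n x | splitAt-↑ˡ m y n = refl

  count-↑ˡ : (p : Fin (m + n) → Bool) → (∀ y → p (m ↑ʳ y) ≡ false) →
             count p ≡ count (p ∘ (_↑ˡ n))
  count-↑ˡ p right-false = begin
    count p                                           ≡⟨ count-↑ m p ⟩
    count (p ∘ (_↑ˡ n)) + count (p ∘ (m ↑ʳ_))         ≡⟨ cong (count (p ∘ (_↑ˡ n)) +_) (count-none right-false) ⟩
    count (p ∘ (_↑ˡ n)) + 0                           ≡⟨ +-identityʳ _ ⟩
    count (p ∘ (_↑ˡ n))                               ∎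
    where open ≡-Reasoning

  count-↑ʳ : (p : Fin (m + n) → Bool) → (∀ y → p (y ↑ˡ n) ≡ false) →
             count p ≡ count (p ∘ (m ↑ʳ_))
  count-↑ʳ p left-false = trans (count-↑ m p) (cong (_+ count (p ∘ (m ↑ʳ_))) (count-none left-false))

  α-⊞-↑ˡ : ∀ x → α (P ⊞ Q) (x ↑ˡ n) ≡ α P x
  α-⊞-↑ˡ x = trans (count-↑ˡ _ (λ y → ≼-↑ʳ↑ˡ y x)) (count-cong (λ y → ≼-↑ˡ↑ˡ y x))

  α-⊞-↑ʳ : ∀ x → α (P ⊞ Q) (m ↑ʳ x) ≡ α Q x
  α-⊞-↑ʳ x = trans (count-↑ʳ _ (λ y → ≼-↑ˡ↑ʳ y x)) (count-cong (λ y → ≼-↑ʳ↑ʳ y x))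

  β-⊞-↑ˡ : ∀ x → β (P ⊞ Q) (x ↑ˡ n) ≡ β P x
  β-⊞-↑ˡ x = trans (count-↑ˡ _ (≼-↑ˡ↑ʳ x)) (count-cong (≼-↑ˡ↑ˡ x))

  β-⊞-↑ʳ : ∀ x → β (P ⊞ Q) (m ↑ʳ x) ≡ β Q x
  β-⊞-↑ʳ x = trans (count-↑ʳ _ (≼-↑ʳ↑ˡ x)) (count-cong (≼-↑ʳ↑ʳ x))

  ∏-β-⊞ : ∏ (β (P ⊞ Q)) ≡ ∏ (β P) * ∏ (β Q)
  ∏-β-⊞ = trans (∏-↑ m _) (cong₂ _*_ (∏-cong β-⊞-↑ˡ) (∏-cong β-⊞-↑ʳ))

  ∏-α-⊞ : ∀ k → ∏ (λ x → k + α (P ⊞ Q) x) ≡ ∏ (λ x → k + α P x) * ∏ (λ x → k + α Q x)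
  ∏-α-⊞ k = trans (∏-↑ m _)
    (cong₂ _*_ (∏-cong (cong (k +_) ∘ α-⊞-↑ˡ)) (∏-cong (cong (k +_) ∘ α-⊞-↑ʳ)))

module _ {n} (P : Forest n) where

  α-C₁⊕-zero : α (C₁⊕ P) zero ≡ 1
  α-C₁⊕-zero = trans (count-suc (λ y → (C₁⊕ P) ⊢ y ≼ zero)) (cong suc (count-none {n} (λ _ → refl)))

  α-C₁⊕-suc : ∀ x → α (C₁⊕ P) (suc x) ≡ suc (α P x)
  α-C₁⊕-suc x = count-suc (λ y → (C₁⊕ P) ⊢ y ≼ suc x)

  β-C₁⊕-zero : β (C₁⊕ P) zero ≡ suc n
  β-C₁⊕-zero = count-all (suc n)

  β-C₁⊕-suc : ∀ x → β (C₁⊕ P) (suc x) ≡ β P x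
  β-C₁⊕-suc x = count-suc (λ y → (C₁⊕ P) ⊢ suc x ≼ y)

  ∏-β-C₁⊕ : ∏ (β (C₁⊕ P)) ≡ suc n * ∏ (β P)
  ∏-β-C₁⊕ = trans (∏-suc (β (C₁⊕ P))) (cong₂ _*_ β-C₁⊕-zero (∏-cong β-C₁⊕-suc))

  ∏-α-C₁⊕ : ∀ k → ∏ (λ x → k + α (C₁⊕ P) x) ≡ suc k * ∏ (λ x → suc k + α P x)
  ∏-α-C₁⊕ k = trans (∏-suc (λ x → k + α (C₁⊕ P) x)) (cong₂ _*_ root rest)
    where
    root : k + α (C₁⊕ P) zero ≡ suc k
    root = trans (cong (k +_) α-C₁⊕-zero) (+-comm k 1)
    rest : ∏ (λ x → k + α (C₁⊕ P) (suc x)) ≡ ∏ (λ x → suc k + α P x)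
    rest = ∏-cong (λ x → trans (cong (k +_) (α-C₁⊕-suc x)) (+-suc k (α P x)))

-- rising n k = (n + 1)(n + 2)⋯(n + k) = C(n + k, k) · k!
rising : ℕ → ℕ → ℕ
rising n zero    = 1
rising n (suc k) = (n + suc k) * rising n k

rising-suc : ∀ n k → rising n (suc k) ≡ suc n * rising (suc n) k
rising-suc n zero    = cong (_* 1) (+-comm n 1)
rising-suc n (suc k) = begin
  (n + suc (suc k)) * ((n + suc k) * rising n k) ≡⟨ cong₂ _*_ (+-suc n (suc k)) (rising-suc n k) ⟩
  (suc n + suc k) * (suc n * rising (suc n) k)   ≡⟨ x∙yz≈y∙xz (suc n + suc k) (suc n) _ ⟩
  suc n * ((suc n + suc k) * rising (suc n) k)   ∎
  where open ≡-Reasoning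

rising-one : ∀ k → rising 1 k ≡ suc k !
rising-one zero    = refl
rising-one (suc k) = cong (suc (suc k) *_) (rising-one k)

[m+n+o]*o≤[m+o]*[n+o] : ∀ m n o → (m + n + o) * o ≤ (m + o) * (n + o)
[m+n+o]*o≤[m+o]*[n+o] m n o = begin
  (m + n + o) * o         ≤⟨ m≤n+m _ (m * n) ⟩
  m * n + (m + n + o) * o ≡⟨ solve (m ∷ n ∷ o ∷ []) ⟩
  (m + o) * (n + o)       ∎
  where open ≤-Reasoning

rising-+ : ∀ m n k → rising (m + n) k * k ! ≤ rising m k * rising n k
rising-+ m n zero    = ≤-refl
rising-+ m n (suc k) = begin
  ((m + n + suc k) * rising (m + n) k) * (suc k * k !)
    ≡⟨ [m*n]*[o*p]≡[m*o]*[n*p] (m + n + suc k) _ (suc k) _ ⟩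
  ((m + n + suc k) * suc k) * (rising (m + n) k * k !)
    ≤⟨ *-mono-≤ ([m+n+o]*o≤[m+o]*[n+o] m n (suc k)) (rising-+ m n k) ⟩
  ((m + suc k) * (n + suc k)) * (rising m k * rising n k)
    ≡⟨ [m*n]*[o*p]≡[m*o]*[n*p] (m + suc k) _ _ _ ⟩
  ((m + suc k) * rising m k) * ((n + suc k) * rising n k) ∎
  where open ≤-Reasoning

∏β*rising≤∏[k+α]*k! : ∀ {n} (P : Forest n) k →
  ∏ (β P) * rising n k ≤ ∏ (λ x → k + α P x) * k !
∏β*rising≤∏[k+α]*k! one k = ≤-reflexive (begin
  1 * rising 1 k           ≡⟨ *-identityˡ (rising 1 k) ⟩
  rising 1 k               ≡⟨ rising-one k ⟩
  suc k * k !              ≡⟨ cong (_* k !) (trans (+-comm 1 k) (sym (*-identityʳ (k + 1)))) ⟩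
  ((k + 1) * 1) * k !      ∎)
  where open ≡-Reasoning
∏β*rising≤∏[k+α]*k! (_⊞_ {m} {n} P Q) k rewrite ∏-β-⊞ P Q | ∏-α-⊞ P Q k =
  *-cancelʳ-≤ _ _ (k !) {{k !≢0}} (begin
    ((bP * bQ) * rising (m + n) k) * k ! ≡⟨ *-assoc (bP * bQ) _ _ ⟩
    (bP * bQ) * (rising (m + n) k * k !) ≤⟨ *-monoʳ-≤ (bP * bQ) (rising-+ m n k) ⟩
    (bP * bQ) * (rising m k * rising n k) ≡⟨ [m*n]*[o*p]≡[m*o]*[n*p] bP bQ _ _ ⟩
    (bP * rising m k) * (bQ * rising n k) ≤⟨ *-mono-≤ (∏β*rising≤∏[k+α]*k! P k) (∏β*rising≤∏[k+α]*k! Q k) ⟩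
    (aP * k !) * (aQ * k !)              ≡⟨ [m*n]*[o*p]≡[m*o]*[n*p] aP (k !) aQ (k !) ⟩
    (aP * aQ) * (k ! * k !)              ≡⟨ *-assoc (aP * aQ) _ _ ⟨
    ((aP * aQ) * k !) * k !              ∎)
  where
  open ≤-Reasoning
  bP bQ aP aQ : ℕ
  bP = ∏ (β P)
  bQ = ∏ (β Q)
  aP = ∏ (λ x → k + α P x)
  aQ = ∏ (λ x → k + α Q x)
∏β*rising≤∏[k+α]*k! (C₁⊕_ {n} P) k = begin
  ∏ (β (C₁⊕ P)) * rising (suc n) k      ≡⟨ cong (_* rising (suc n) k) (∏-β-C₁⊕ P) ⟩
  (suc n * ∏ (β P)) * rising (suc n) k  ≡⟨ xy∙z≈y∙xz (suc n) (∏ (β P)) _ ⟩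
  ∏ (β P) * (suc n * rising (suc n) k)  ≡⟨ cong (∏ (β P) *_) (rising-suc n k) ⟨
  ∏ (β P) * rising n (suc k)            ≤⟨ ∏β*rising≤∏[k+α]*k! P (suc k) ⟩
  a′ * (suc k * k !)                    ≡⟨ x∙yz≈yx∙z a′ (suc k) (k !) ⟩
  (suc k * a′) * k !                    ≡⟨ cong (_* k !) (∏-α-C₁⊕ P k) ⟨
  ∏ (λ x → k + α (C₁⊕ P) x) * k !       ∎
  where
  open ≤-Reasoning
  a′ : ℕ
  a′ = ∏ (λ x → suc k + α P x)

corollary6p2 : ∀ {n} (P : Forest n) → ∏ (α P) ≥ ∏ (β P)
corollary6p2 P =
  subst₂ _≤_ (*-identityʳ (∏ (β P))) (*-identityʳ (∏ (α P))) (∏β*rising≤∏[k+α]*k! P 0)
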